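{- For positive integers $b$ and $j$ let \[ B_j(b)= b^2\binom{(j+2)b-2}{b-1}\left(\tfrac12\right)^{(j+2)b-1}. \] Then $B_{j+1}(b)\le \tfrac12\, B_j(b)$ for all $b\in\mathbb{N}$, $b\ge1$, and all $j\ge1$.
   Context: In the paper, $B_j(b)$ is the upper bound on $E[H_j]$, the expected number of "holes" in the $j$-th region (of $b$ slots) of a shared buffer of size $2k$, under a uniform stochastic scheduler. -}

module Defs where

open import Data.Nat using (ℕ; suc; _+_; _*_; _∸_; _^_)
open import Data.Nat.Combinatorics using (_C_)
open import Data.Integer using (+_)
open import Data.Rational using (ℚ; _/_)
import Data.Nat.Properties as ℕP

B : ℕ → ℕ → ℚ
B j b = _/_ (+ (b * b * (((j + 2) * b ∸ 2) C (b ∸ 1)))) (2 ^ e) {{ℕP.m^n≢0 2 e}}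
  where e = (j + 2) * b ∸ 1

-- With b = k + 1 and n = (j + 2) b − 2, passing from j to j + 1 adds b to the top of the
-- binomial coefficient and to the exponent of 2, so the claim is C(n + b, k) ≤ 2^k C(n, k).
-- By absorption, raising the top m of C(m, k) by one multiplies it by (m + 1) / (m + 1 − k),
-- which is at most 2 while m ≥ 2k − 1; since n ≥ 3k + 1, this covers all b steps.
module Submission where

module HoleBound where
  open import Data.Nat using (ℕ; zero; suc; _+_; _*_; _∸_; _^_; _≤_; s≤s; z≤n; NonZero)
  open import Data.Nat.Properties
  open import Data.Nat.Combinatorics using (_C_; nC1≡n; nCk+nC[k+1]≡[n+1]C[k+1])
  open import Data.Nat.Tactic.RingSolver using (solve-∀)
  import Data.Integer as ℤ
  import Data.Integer.Properties as ℤ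
  import Data.Rational as ℚ
  import Data.Rational.Properties as ℚ
  import Data.Rational.Unnormalised as ℚᵘ
  import Data.Rational.Unnormalised.Properties as ℚᵘ
  open import Relation.Binary.PropositionalEquality
    using (_≡_; sym; trans; cong; cong₂; subst; subst₂; module ≡-Reasoning)
  open import Relation.Nullary using (contradiction)

  open import Defs

  [1+k]*[1+n]C[1+k]≡[1+n]*nCk : ∀ n k → suc k * (suc n C suc k) ≡ suc n * (n C k)
  [1+k]*[1+n]C[1+k]≡[1+n]*nCk n zero = begin
    1 * (suc n C 1)  ≡⟨ *-identityˡ (suc n C 1) ⟩
    suc n C 1        ≡⟨ nC1≡n (suc n) ⟩
    suc n            ≡⟨ *-identityʳ (suc n) ⟨
    suc n * 1        ∎
    where open ≡-Reasoning
  [1+k]*[1+n]C[1+k]≡[1+n]*nCk zero (suc k) = *-zeroʳ (suc (suc k))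
  [1+k]*[1+n]C[1+k]≡[1+n]*nCk (suc n) (suc k) = begin
    suc (suc k) * (suc (suc n) C suc (suc k))
      ≡⟨ cong (suc (suc k) *_) (nCk+nC[k+1]≡[n+1]C[k+1] (suc n) (suc k)) ⟨
    suc (suc k) * (c + suc n C suc (suc k))
      ≡⟨ *-distribˡ-+ (suc (suc k)) c (suc n C suc (suc k)) ⟩
    (c + suc k * c) + suc (suc k) * (suc n C suc (suc k))
      ≡⟨ cong₂ (λ x y → (c + x) + y) ([1+k]*[1+n]C[1+k]≡[1+n]*nCk n k)
                                     ([1+k]*[1+n]C[1+k]≡[1+n]*nCk n (suc k)) ⟩
    (c + suc n * (n C k)) + suc n * (n C suc k)
      ≡⟨ +-assoc c (suc n * (n C k)) (suc n * (n C suc k)) ⟩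
    c + (suc n * (n C k) + suc n * (n C suc k))
      ≡⟨ cong (c +_) (*-distribˡ-+ (suc n) (n C k) (n C suc k)) ⟨
    c + suc n * (n C k + n C suc k)
      ≡⟨ cong (λ x → c + suc n * x) (nCk+nC[k+1]≡[n+1]C[k+1] n k) ⟩
    c + suc n * c
      ∎
    where
    c : ℕ
    c = suc n C suc k
    open ≡-Reasoning

  [m+d]Ck≤2^k*mCk : ∀ k m d → k + d ≤ suc m → (m + d) C k ≤ 2 ^ k * (m C k)
  [m+d]Ck≤2^k*mCk zero    m       d       _       = ≤-refl
  [m+d]Ck≤2^k*mCk (suc k) zero    zero    _       = z≤n
  [m+d]Ck≤2^k*mCk (suc k) zero    (suc d) (s≤s h) = contradiction (m+n≤o⇒n≤o k h) λ ()
  [m+d]Ck≤2^k*mCk (suc k) (suc m) d       (s≤s h) = *-cancelˡ-≤ (suc k) (begin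
    suc k * ((suc m + d) C suc k)        ≡⟨ [1+k]*[1+n]C[1+k]≡[1+n]*nCk (m + d) k ⟩
    suc (m + d) * ((m + d) C k)          ≤⟨ *-monoʳ-≤ (suc (m + d)) ([m+d]Ck≤2^k*mCk k m d h) ⟩
    suc (m + d) * (2 ^ k * (m C k))      ≤⟨ *-monoˡ-≤ (2 ^ k * (m C k)) (+-monoʳ-≤ (suc m) d≤1+m) ⟩
    (suc m + suc m) * (2 ^ k * (m C k))  ≡⟨ doubling m (2 ^ k) (m C k) ⟩
    2 ^ suc k * (suc m * (m C k))        ≡⟨ cong (2 ^ suc k *_) ([1+k]*[1+n]C[1+k]≡[1+n]*nCk m k) ⟨
    2 ^ suc k * (suc k * (suc m C suc k))  ≡⟨ x*[y*z]≡y*[x*z] (2 ^ suc k) (suc k) (suc m C suc k) ⟩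
    suc k * (2 ^ suc k * (suc m C suc k))  ∎)
    where
    open ≤-Reasoning
    d≤1+m : d ≤ suc m
    d≤1+m = m+n≤o⇒n≤o k h
    doubling : ∀ m p c → (suc m + suc m) * (p * c) ≡ 2 * p * (suc m * c)
    doubling = solve-∀
    x*[y*z]≡y*[x*z] : ∀ x y z → x * (y * z) ≡ y * (x * z)
    x*[y*z]≡y*[x*z] = solve-∀

  toℚᵘ-/ : ∀ i d .{{_ : NonZero d}} → ℚ.toℚᵘ (i ℚ./ d) ℚᵘ.≃ i ℚᵘ./ d
  toℚᵘ-/ i (suc d) = ℚ.toℚᵘ-fromℚᵘ (ℚᵘ.mkℚᵘ i d)

  /≤½*/ : ∀ x y d₁ d₂ .{{_ : NonZero d₁}} .{{_ : NonZero d₂}} →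
          x * (2 * d₂) ≤ y * d₁ → ℤ.+ x ℚ./ d₁ ℚ.≤ ℚ.½ ℚ.* (ℤ.+ y ℚ./ d₂)
  /≤½*/ x y d₁@(suc _) d₂@(suc _) h = ℚ.toℚᵘ-cancel-≤ (begin
    ℚ.toℚᵘ (ℤ.+ x ℚ./ d₁)                   ≃⟨ toℚᵘ-/ (ℤ.+ x) d₁ ⟩
    ℤ.+ x ℚᵘ./ d₁                            ≤⟨ ℚᵘ.*≤* cross-multiplied ⟩
    ℚᵘ.½ ℚᵘ.* (ℤ.+ y ℚᵘ./ d₂)                ≃⟨ ℚᵘ.*-congˡ {ℚᵘ.½} (toℚᵘ-/ (ℤ.+ y) d₂) ⟨
    ℚ.toℚᵘ ℚ.½ ℚᵘ.* ℚ.toℚᵘ (ℤ.+ y ℚ./ d₂)    ≃⟨ ℚ.toℚᵘ-homo-* ℚ.½ (ℤ.+ y ℚ./ d₂) ⟨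
    ℚ.toℚᵘ (ℚ.½ ℚ.* (ℤ.+ y ℚ./ d₂))          ∎)
    where
    open ℚᵘ.≤-Reasoning
    cross-multiplied : ℤ.+ x ℤ.* ℤ.+ (2 * d₂) ℤ.≤ ℤ.+ 1 ℤ.* ℤ.+ y ℤ.* ℤ.+ d₁
    cross-multiplied = subst₂ ℤ._≤_ (ℤ.pos-* x (2 * d₂))
      (trans (ℤ.pos-* y d₁) (cong (ℤ._* ℤ.+ d₁) (sym (ℤ.*-identityˡ (ℤ.+ y))))) (ℤ.+≤+ h)

  -- B j b ≡ B′ b ((j + 2) * b) definitionally.
  B′ : ℕ → ℕ → ℚ.ℚ
  B′ b N = (ℤ.+ (b * b * ((N ∸ 2) C (b ∸ 1))) ℚ./ 2 ^ (N ∸ 1)) {{m^n≢0 2 (N ∸ 1)}}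

  B′-step : ∀ k n → k + k ≤ n → B′ (suc k) (2 + n + suc k) ℚ.≤ ℚ.½ ℚ.* B′ (suc k) (2 + n)
  B′-step k n h =
    /≤½*/ (b² * ((n + suc k) C k)) (b² * (n C k)) (2 ^ suc (n + suc k)) (2 ^ suc n)
          {{m^n≢0 2 (suc (n + suc k))}} {{m^n≢0 2 (suc n)}} (begin
    b² * ((n + suc k) C k) * (2 * 2 ^ suc n)      ≤⟨ *-monoˡ-≤ (2 * 2 ^ suc n) (*-monoʳ-≤ b² C-bound) ⟩
    b² * (2 ^ k * (n C k)) * (2 * 2 ^ suc n)      ≡⟨ regroup b² (n C k) (2 ^ k) (2 ^ n) ⟩
    b² * (n C k) * (2 * (2 ^ n * 2 ^ suc k))      ≡⟨ cong (λ x → b² * (n C k) * (2 * x)) (^-distribˡ-+-* 2 n (suc k)) ⟨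
    b² * (n C k) * 2 ^ suc (n + suc k)            ∎)
    where
    open ≤-Reasoning
    b² : ℕ
    b² = suc k * suc k
    C-bound : (n + suc k) C k ≤ 2 ^ k * (n C k)
    C-bound = [m+d]Ck≤2^k*mCk k n (suc k) (subst (_≤ suc n) (sym (+-suc k k)) (s≤s h))
    regroup : ∀ a c p q → a * (p * c) * (2 * (2 * q)) ≡ a * c * (2 * (q * (2 * p)))
    regroup = solve-∀

  B-step : ∀ k i → B (suc (suc i)) (suc k) ℚ.≤ ℚ.½ ℚ.* B (suc i) (suc k)
  B-step k i = subst₂ (λ N N′ → B′ (suc k) N′ ℚ.≤ ℚ.½ ℚ.* B′ (suc k) N) (N≡ k i) (N′≡ k i)
    (B′-step k n (m≤m+n (k + k) (suc (k + i * suc k))))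
    where
    n : ℕ
    n = k + k + suc (k + i * suc k)
    N≡ : ∀ k i → 2 + (k + k + suc (k + i * suc k)) ≡ (suc i + 2) * suc k
    N≡ = solve-∀
    N′≡ : ∀ k i → 2 + (k + k + suc (k + i * suc k)) + suc k ≡ (suc (suc i) + 2) * suc k
    N′≡ = solve-∀

open import Defs
open import Data.Nat using (ℕ; suc) renaming (_≤_ to _≤ℕ_)
open import Data.Rational using (ℚ; _≤_; _*_; ½)

mainTheorem4 : ∀ (b j : ℕ) → 1 ≤ℕ b → 1 ≤ℕ j → B (suc j) b ≤ ½ * B j b
mainTheorem4 (suc k) (suc i) _ _ = HoleBound.B-step k i
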